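{- Let $n\geq 1$ and $k\geq 1$ be integers. Let $R_{2}^{(k)}$ denote the number of tuples $(Y_1,Y_2,U_{1}^{(1)},\ldots,U_{n}^{(1)},U_{1}^{(2)},\ldots,U_{n}^{(2)})\in(\mathbb{F}_{2}[T])^{2n+2}$ satisfying the degree conditions $\deg Y_i\leq k-1$ for $i=1,2$ and $\deg U_{j}^{(i)}\leq 1$ for $1\leq j\leq n$, $1\leq i\leq 2$ (the zero polynomial is allowed, with degree $-\infty$), and solving the polynomial system $$Y_{1}U_{j}^{(1)}+Y_{2}U_{j}^{(2)}=0\qquad (j=1,\ldots,n).$$ Then $$R_{2}^{(k)}=2^{2k}+3\cdot(2^{2n}-1)\cdot 2^{k}+6\cdot(2^{n}-1)\cdot 2^{k-1}+2^{4n}-3\cdot 2^{2n}-6\cdot 2^{n}+8.$$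
   Context: $\mathbb{F}_2$ is the field with two elements and $\mathbb{F}_2[T]$ the polynomial ring over it. -}

module Defs where

open import Data.Bool using (Bool; true; false; _xor_; _∧_; _∨_; not; if_then_else_)
open import Data.Nat using (ℕ; zero; suc)
open import Data.List using (List; []; _∷_; concatMap; map)
open import Data.Bool.ListAction using (and; all)
open import Data.Vec using (Vec; []; _∷_; toList; zipWith)
open import Data.Product using (_×_; _,_)

-- 𝔽₂ is represented by Bool: addition = xor, multiplication = ∧.
-- A polynomial in 𝔽₂[T] is a (not necessarily normalised) coefficient list,
-- the i-th entry being the coefficient of T^i.
Poly : Set
Poly = List Bool

_⊕_ : Poly → Poly → Poly
[] ⊕ q = q
(a ∷ p) ⊕ [] = a ∷ p
(a ∷ p) ⊕ (b ∷ q) = (a xor b) ∷ (p ⊕ q)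

scale : Bool → Poly → Poly
scale a q = map (a ∧_) q

_⊗_ : Poly → Poly → Poly
[] ⊗ q = []
(a ∷ p) ⊗ q = scale a q ⊕ (false ∷ (p ⊗ q))

isZero : Poly → Bool
isZero p = all not p

-- Polynomials of degree ≤ d - 1 (including 0) are exactly the coefficient vectors
-- of length d: PolyLt d.
PolyLt : ℕ → Set
PolyLt d = Vec Bool d

toPoly : ∀ {d} → PolyLt d → Poly
toPoly = toList

allVecs : (d : ℕ) → List (Vec Bool d)
allVecs zero = [] ∷ []
allVecs (suc d) = concatMap (λ v → (false ∷ v) ∷ (true ∷ v) ∷ []) (allVecs d)

allVecsOf : {A : Set} → List A → (n : ℕ) → List (Vec A n)
allVecsOf xs zero = [] ∷ []
allVecsOf xs (suc n) = concatMap (λ v → map (λ x → x ∷ v) xs) (allVecsOf xs n)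

count : {A : Set} → (A → Bool) → List A → ℕ
count p [] = zero
count p (x ∷ xs) = if p x then suc (count p xs) else count p xs

Tuple : ℕ → ℕ → Set
Tuple n k = (PolyLt k × PolyLt k) × (Vec (PolyLt 2) n × Vec (PolyLt 2) n)

allTuples : (n k : ℕ) → List (Tuple n k)
allTuples n k =
  concatMap (λ y1 → concatMap (λ y2 → concatMap (λ u1 → map (λ u2 → (y1 , y2) , (u1 , u2))
    (allVecsOf (allVecs 2) n)) (allVecsOf (allVecs 2) n)) (allVecs k)) (allVecs k)

solves : ∀ {n k} → Tuple n k → Bool
solves ((y1 , y2) , (u1 , u2)) =
  and (toList (zipWith (λ a b → isZero ((toPoly y1 ⊗ toPoly a) ⊕ (toPoly y2 ⊗ toPoly b))) u1 u2))

R2 : ℕ → ℕ → ℕ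
R2 n k = count solves (allTuples n k)

module Submission where

-- Write Y = (Y₁ , Y₂) and, for a pair (a , b) of polynomials of
-- degree ≤ 1, say that (a , b) solves Y if Y₁ a + Y₂ b = 0.  The n equations
-- of the system are independent copies of one equation, so
--     R₂⁽ᵏ⁾ = Σ_Y N(Y)ⁿ,   N(Y) = #{ (a , b) : (a , b) solves Y }.
-- Comparing coefficients of Tⁱ, "(a , b) solves Y" is a conjunction of local
-- conditions, each involving only the coefficients of Y at degrees i and i-1.
-- Hence the solution set ("mask") of Y, a subset of the 16 pairs (a , b), is
-- computed by a finite automaton reading the coefficients of Y, whose state is
-- the pair of previous coefficients (the carry).  Consequently every
-- weighted count  E k (φ) = Σ_{deg Y < k} φ(mask Y)  satisfies a transfer
-- identity expressing E (k+1) through E k at the four possible carries, and so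
-- the linear recurrence  E(k+3) - 7E(k+2) + 14E(k+1) - 8E(k) = 0  (roots 1, 2, 4)
-- propagates from k = 1, where it is a finite identity between formal sums of
-- masks, checked by computation.  A sequence satisfying this recurrence is
-- determined by three values, and R₂⁽ᵏ⁾ for k = 1, 2, 3 are read off from the
-- distribution of the sizes of the masks; this yields the closed formula.

open import Defs
open import Data.Nat using (ℕ; _≥_; _∸_)
open import Data.Integer using (ℤ; +_; _+_; _-_; _*_; _^_)
open import Relation.Binary.PropositionalEquality using (_≡_)

open import Data.Nat using (zero; suc) renaming (_+_ to _+ₙ_; _*_ to _*ₙ_)
open import Data.Integer using (-_)
import Data.Integer.Properties as ℤ
import Data.Nat.Properties as ℕ
open import Data.Bool using (Bool; true; false; not; _∧_; _xor_)
open import Data.Bool.Properties using (∧-identityʳ; xor-comm; xor-assoc) renaming (_≟_ to _≟ᵇ_)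
open import Data.Bool.ListAction using (and)
open import Data.List using (List; []; _∷_; concatMap; map; zipWith; _++_; foldr)
open import Data.List.Properties using (≡-dec)
open import Data.List.Relation.Unary.All using (All; []; _∷_; all?)
open import Data.Vec using (Vec; []; _∷_; toList)
import Data.Vec as Vec
open import Data.Product using (_×_; _,_; proj₁; proj₂)
open import Relation.Binary using (DecidableEquality)
open import Relation.Nullary using (yes; no)
open import Relation.Nullary.Decidable using (True; toWitness)
open import Relation.Binary.PropositionalEquality using (refl; sym; trans; cong; cong₂; module ≡-Reasoning)
open import Data.Integer.Tactic.RingSolver using (solve-∀)

open ≡-Reasoning

∑ : {A : Set} → List A → (A → ℤ) → ℤ
∑ [] f = + 0
∑ (x ∷ xs) f = f x + ∑ xs f

∑-cong : ∀ {A : Set} (xs : List A) {f g : A → ℤ} → (∀ x → f x ≡ g x) → ∑ xs f ≡ ∑ xs g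
∑-cong [] e = refl
∑-cong (x ∷ xs) e = cong₂ _+_ (e x) (∑-cong xs e)

∑-++ : ∀ {A : Set} (xs ys : List A) (f : A → ℤ) → ∑ (xs ++ ys) f ≡ ∑ xs f + ∑ ys f
∑-++ [] ys f = sym (ℤ.+-identityˡ _)
∑-++ (x ∷ xs) ys f = trans (cong (_+_ (f x)) (∑-++ xs ys f)) (sym (ℤ.+-assoc (f x) (∑ xs f) (∑ ys f)))

∑-map : ∀ {A B : Set} (g : A → B) (xs : List A) (f : B → ℤ) → ∑ (map g xs) f ≡ ∑ xs (λ x → f (g x))
∑-map g [] f = refl
∑-map g (x ∷ xs) f = cong (_+_ (f (g x))) (∑-map g xs f)

∑-concatMap : ∀ {A B : Set} (g : A → List B) (xs : List A) (f : B → ℤ) →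
  ∑ (concatMap g xs) f ≡ ∑ xs (λ x → ∑ (g x) f)
∑-concatMap g [] f = refl
∑-concatMap g (x ∷ xs) f = trans (∑-++ (g x) (concatMap g xs) f) (cong (_+_ (∑ (g x) f)) (∑-concatMap g xs f))

∑-+ : ∀ {A : Set} (xs : List A) (f g : A → ℤ) → ∑ xs (λ x → f x + g x) ≡ ∑ xs f + ∑ xs g
∑-+ [] f g = refl
∑-+ (x ∷ xs) f g = trans (cong (_+_ (f x + g x)) (∑-+ xs f g)) (interchange (f x) (g x) (∑ xs f) (∑ xs g))
  where
  interchange : ∀ a b c d → (a + b) + (c + d) ≡ (a + c) + (b + d)
  interchange = solve-∀

∑-*ˡ : ∀ {A : Set} (xs : List A) (c : ℤ) (f : A → ℤ) → ∑ xs (λ x → c * f x) ≡ c * ∑ xs f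
∑-*ˡ [] c f = sym (ℤ.*-zeroʳ c)
∑-*ˡ (x ∷ xs) c f = trans (cong (_+_ (c * f x)) (∑-*ˡ xs c f)) (sym (ℤ.*-distribˡ-+ c (f x) (∑ xs f)))

∑-*ʳ : ∀ {A : Set} (xs : List A) (c : ℤ) (f : A → ℤ) → ∑ xs (λ x → f x * c) ≡ ∑ xs f * c
∑-*ʳ xs c f = trans (∑-cong xs (λ x → ℤ.*-comm (f x) c)) (trans (∑-*ˡ xs c f) (ℤ.*-comm c (∑ xs f)))

∑-factor : ∀ {A B : Set} (xs : List A) (ys : List B) (f : A → ℤ) (g : B → ℤ) →
  ∑ xs (λ x → ∑ ys (λ y → f x * g y)) ≡ ∑ xs f * ∑ ys g
∑-factor xs ys f g = trans (∑-cong xs (λ x → ∑-*ˡ ys (f x) g)) (∑-*ʳ xs (∑ ys g) f)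

ind : Bool → ℤ
ind true = + 1
ind false = + 0

ind-∧ : ∀ a b → ind (a ∧ b) ≡ ind a * ind b
ind-∧ false b = refl
ind-∧ true false = refl
ind-∧ true true = refl

count-∑ : ∀ {A : Set} (p : A → Bool) (xs : List A) → + count p xs ≡ ∑ xs (λ x → ind (p x))
count-∑ p [] = refl
count-∑ p (x ∷ xs) with p x
... | true = cong (_+_ (+ 1)) (count-∑ p xs)
... | false = trans (count-∑ p xs) (sym (ℤ.+-identityˡ _))

∑-allVecsOf-suc : ∀ {A : Set} (L : List A) n (f : Vec A (suc n) → ℤ) →
  ∑ (allVecsOf L (suc n)) f ≡ ∑ (allVecsOf L n) (λ v → ∑ L (λ x → f (x ∷ v)))
∑-allVecsOf-suc L n f = trans (∑-concatMap _ (allVecsOf L n) f) (∑-cong (allVecsOf L n) (λ v → ∑-map _ L f))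

∑-independent : ∀ {A : Set} (L : List A) (P : A → A → Bool) (n : ℕ) →
  ∑ (allVecsOf L n) (λ u₁ → ∑ (allVecsOf L n) (λ u₂ → ind (and (toList (Vec.zipWith P u₁ u₂)))))
  ≡ ∑ L (λ a → ∑ L (λ b → ind (P a b))) ^ n
∑-independent L P zero = refl
∑-independent {A} L P (suc n) = begin
    ∑ (allVecsOf L (suc n)) (λ u₁ → ∑ (allVecsOf L (suc n)) (λ u₂ → agree u₁ u₂))
  ≡⟨ ∑-allVecsOf-suc L n _ ⟩
    ∑ U (λ v₁ → ∑ L (λ a → ∑ (allVecsOf L (suc n)) (λ u₂ → agree (a ∷ v₁) u₂)))
  ≡⟨ ∑-cong U (λ v₁ → ∑-cong L (λ a → ∑-allVecsOf-suc L n _)) ⟩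
    ∑ U (λ v₁ → ∑ L (λ a → ∑ U (λ v₂ → ∑ L (λ b → ind (P a b ∧ holds v₁ v₂)))))
  ≡⟨ ∑-cong U (λ v₁ → ∑-cong L (λ a → ∑-cong U (λ v₂ → ∑-cong L (λ b → ind-∧ (P a b) _)))) ⟩
    ∑ U (λ v₁ → ∑ L (λ a → ∑ U (λ v₂ → ∑ L (λ b → ind (P a b) * agree v₁ v₂))))
  ≡⟨ ∑-cong U (λ v₁ → ∑-cong L (λ a → ∑-cong U (λ v₂ → ∑-*ʳ L _ _))) ⟩
    ∑ U (λ v₁ → ∑ L (λ a → ∑ U (λ v₂ → solutionsOf a * agree v₁ v₂)))
  ≡⟨ ∑-cong U (λ v₁ → ∑-factor L U solutionsOf (agree v₁)) ⟩
    ∑ U (λ v₁ → m * ∑ U (agree v₁))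
  ≡⟨ ∑-*ˡ U m _ ⟩
    m * ∑ U (λ v₁ → ∑ U (agree v₁))
  ≡⟨ cong (m *_) (∑-independent L P n) ⟩
    m * m ^ n ∎
  where
  U : List (Vec A n)
  U = allVecsOf L n
  holds : ∀ {k} → Vec A k → Vec A k → Bool
  holds u₁ u₂ = and (toList (Vec.zipWith P u₁ u₂))
  agree : ∀ {k} → Vec A k → Vec A k → ℤ
  agree u₁ u₂ = ind (holds u₁ u₂)
  solutionsOf : A → ℤ
  solutionsOf a = ∑ L (λ b → ind (P a b))
  m : ℤ
  m = ∑ L solutionsOf

⊕-comm : ∀ p q → p ⊕ q ≡ q ⊕ p
⊕-comm [] [] = refl
⊕-comm [] (b ∷ q) = refl
⊕-comm (a ∷ p) [] = refl
⊕-comm (a ∷ p) (b ∷ q) = cong₂ _∷_ (xor-comm a b) (⊕-comm p q)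

⊕-assoc : ∀ p q r → (p ⊕ q) ⊕ r ≡ p ⊕ (q ⊕ r)
⊕-assoc [] q r = refl
⊕-assoc (a ∷ p) [] r = refl
⊕-assoc (a ∷ p) (b ∷ q) [] = refl
⊕-assoc (a ∷ p) (b ∷ q) (c ∷ r) = cong₂ _∷_ (xor-assoc a b c) (⊕-assoc p q r)

⊕-interchange : ∀ p q r s → (p ⊕ q) ⊕ (r ⊕ s) ≡ (p ⊕ r) ⊕ (q ⊕ s)
⊕-interchange p q r s = begin
    (p ⊕ q) ⊕ (r ⊕ s)  ≡⟨ ⊕-assoc p q (r ⊕ s) ⟩
    p ⊕ (q ⊕ (r ⊕ s))  ≡⟨ cong (p ⊕_) (sym (⊕-assoc q r s)) ⟩
    p ⊕ ((q ⊕ r) ⊕ s)  ≡⟨ cong (λ t → p ⊕ (t ⊕ s)) (⊕-comm q r) ⟩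
    p ⊕ ((r ⊕ q) ⊕ s)  ≡⟨ cong (p ⊕_) (⊕-assoc r q s) ⟩
    p ⊕ (r ⊕ (q ⊕ s))  ≡⟨ sym (⊕-assoc p r (q ⊕ s)) ⟩
    (p ⊕ r) ⊕ (q ⊕ s)  ∎

Pair : Set
Pair = PolyLt 2 × PolyLt 2

pairs : List Pair
pairs = concatMap (λ a → map (a ,_) (allVecs 2)) (allVecs 2)

-- If Y₁ and Y₂ have coefficients (u , w) at degree i-1 and (c₁ , c₂) at
-- degree i, the coefficient of Tⁱ in Y₁ a + Y₂ b is
-- c₁ a₀ + c₂ b₀ + u a₁ + w b₁; coeffOK says it vanishes.
coeffOK : Bool → Bool → Bool → Bool → Pair → Bool
coeffOK u w c₁ c₂ ((a₀ ∷ a₁ ∷ []) , (b₀ ∷ b₁ ∷ [])) =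
  not ((c₁ ∧ a₀) xor ((c₂ ∧ b₀) xor ((u ∧ a₁) xor (w ∧ b₁))))

-- All coefficients from degree i on vanish, given the coefficients (u , w) at
-- degree i-1 and the remaining coefficients y₁, y₂; the last condition is the
-- coefficient of the top degree k, where Y₁, Y₂ themselves vanish.
solvesFrom : ∀ {k} → Bool → Bool → Vec Bool k → Vec Bool k → Pair → Bool
solvesFrom u w [] [] p = coeffOK u w false false p
solvesFrom u w (c₁ ∷ y₁) (c₂ ∷ y₂) p = coeffOK u w c₁ c₂ p ∧ solvesFrom c₁ c₂ y₁ y₂ p

-- The contribution u a₁ + w b₁ of the coefficients at degree i-1, which is
-- carried to degree i when Y₁ a + Y₂ b is computed from the bottom.
carry : Bool → Bool → Pair → Poly
carry u w ((a₀ ∷ a₁ ∷ []) , (b₀ ∷ b₁ ∷ [])) = ((u ∧ a₁) xor (w ∧ b₁)) ∷ []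

-- Invariant of the coefficient comparison: the part of Y₁ a + Y₂ b from degree
-- i on, plus the carry from degree i-1, vanishes iff solvesFrom holds.
isZero-carry : ∀ {k} u w (y₁ y₂ : Vec Bool k) (p : Pair) →
  isZero (carry u w p ⊕ ((toPoly y₁ ⊗ toPoly (proj₁ p)) ⊕ (toPoly y₂ ⊗ toPoly (proj₂ p))))
  ≡ solvesFrom u w y₁ y₂ p
isZero-carry u w [] [] ((a₀ ∷ a₁ ∷ []) , (b₀ ∷ b₁ ∷ [])) = ∧-identityʳ _
isZero-carry u w (c₁ ∷ y₁) (c₂ ∷ y₂) p@((a₀ ∷ a₁ ∷ []) , (b₀ ∷ b₁ ∷ [])) =
  cong₂ _∧_ (lowest (c₁ ∧ a₀) (c₂ ∧ b₀) ((u ∧ a₁) xor (w ∧ b₁)))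
    (trans (cong isZero (⊕-interchange ((c₁ ∧ a₁) ∷ []) (toPoly y₁ ⊗ (a₀ ∷ a₁ ∷ []))
                                       ((c₂ ∧ b₁) ∷ []) (toPoly y₂ ⊗ (b₀ ∷ b₁ ∷ []))))
           (isZero-carry c₁ c₂ y₁ y₂ p))
  where
  lowest : ∀ x y z → not (z xor ((x xor false) xor (y xor false))) ≡ not (x xor (y xor z))
  lowest false false false = refl
  lowest false false true = refl
  lowest false true false = refl
  lowest false true true = refl
  lowest true false false = refl
  lowest true false true = refl
  lowest true true false = refl
  lowest true true true = refl

-- Y₁ a + Y₂ b = 0 iff all its coefficients vanish, as computed by solvesFrom
-- starting with zero coefficients below degree 0.
solves-coefficientwise : ∀ {k} (y₁ y₂ : Vec Bool k) (p : Pair) →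
  isZero ((toPoly y₁ ⊗ toPoly (proj₁ p)) ⊕ (toPoly y₂ ⊗ toPoly (proj₂ p))) ≡ solvesFrom false false y₁ y₂ p
solves-coefficientwise y₁ y₂ p@((a₀ ∷ a₁ ∷ []) , (b₀ ∷ b₁ ∷ [])) =
  trans (sym (isZero-false-∷ ((toPoly y₁ ⊗ toPoly (proj₁ p)) ⊕ (toPoly y₂ ⊗ toPoly (proj₂ p)))))
        (isZero-carry false false y₁ y₂ p)
  where
  isZero-false-∷ : ∀ q → isZero ((false ∷ []) ⊕ q) ≡ isZero q
  isZero-false-∷ [] = refl
  isZero-false-∷ (b ∷ q) = refl

∑-pairs : (f : Pair → ℤ) → ∑ pairs f ≡ ∑ (allVecs 2) (λ a → ∑ (allVecs 2) (λ b → f (a , b)))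
∑-pairs f = trans (∑-concatMap (λ a → map (a ,_) (allVecs 2)) (allVecs 2) f) (∑-cong (allVecs 2) (λ a → ∑-map (a ,_) (allVecs 2) f))

-- A set of pairs, given by its membership bits along the list `pairs`.
Mask : Set
Mask = List Bool

_∩_ : Mask → Mask → Mask
_∩_ = zipWith _∧_

size : Mask → ℕ
size = count (λ b → b)

mask : ∀ {k} → Bool → Bool → Vec Bool k → Vec Bool k → Mask
mask u w y₁ y₂ = map (solvesFrom u w y₁ y₂) pairs

local : Bool → Bool → Bool → Bool → Mask
local u w c₁ c₂ = map (coeffOK u w c₁ c₂) pairs

map-∧ : ∀ {A : Set} (f g : A → Bool) (xs : List A) → map (λ x → f x ∧ g x) xs ≡ map f xs ∩ map g xs
map-∧ f g [] = refl
map-∧ f g (x ∷ xs) = cong (f x ∧ g x ∷_) (map-∧ f g xs)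

mask-∷ : ∀ {k} u w c₁ c₂ (y₁ y₂ : Vec Bool k) → mask u w (c₁ ∷ y₁) (c₂ ∷ y₂) ≡ local u w c₁ c₂ ∩ mask c₁ c₂ y₁ y₂
mask-∷ u w c₁ c₂ y₁ y₂ = map-∧ (coeffOK u w c₁ c₂) (solvesFrom c₁ c₂ y₁ y₂) pairs

solutionCount : ∀ {k} (y₁ y₂ : Vec Bool k) →
  ∑ (allVecs 2) (λ a → ∑ (allVecs 2) (λ b → ind (isZero ((toPoly y₁ ⊗ toPoly a) ⊕ (toPoly y₂ ⊗ toPoly b)))))
  ≡ + size (mask false false y₁ y₂)
solutionCount y₁ y₂ = begin
    ∑ (allVecs 2) (λ a → ∑ (allVecs 2) (λ b → ind (isZero ((toPoly y₁ ⊗ toPoly a) ⊕ (toPoly y₂ ⊗ toPoly b)))))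
  ≡⟨ ∑-cong (allVecs 2) (λ a → ∑-cong (allVecs 2) (λ b → cong ind (solves-coefficientwise y₁ y₂ (a , b)))) ⟩
    ∑ (allVecs 2) (λ a → ∑ (allVecs 2) (λ b → ind (solvesFrom false false y₁ y₂ (a , b))))
  ≡⟨ sym (∑-pairs (λ p → ind (solvesFrom false false y₁ y₂ p))) ⟩
    ∑ pairs (λ p → ind (solvesFrom false false y₁ y₂ p))
  ≡⟨ sym (∑-map (solvesFrom false false y₁ y₂) pairs ind) ⟩
    ∑ (mask false false y₁ y₂) ind
  ≡⟨ sym (count-∑ (λ b → b) (mask false false y₁ y₂)) ⟩
    + size (mask false false y₁ y₂) ∎

E : ℕ → Bool → Bool → (Mask → ℤ) → ℤ
E k u w φ = ∑ (allVecs k) (λ y₁ → ∑ (allVecs k) (λ y₂ → φ (mask u w y₁ y₂)))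

R2≡E : ∀ n k → + R2 n k ≡ E k false false (λ W → (+ size W) ^ n)
R2≡E n k = begin
    + count solves (allTuples n k)
  ≡⟨ count-∑ solves (allTuples n k) ⟩
    ∑ (allTuples n k) (λ t → ind (solves t))
  ≡⟨ trans (∑-concatMap _ Y _) (∑-cong Y (λ y₁ → trans (∑-concatMap _ Y _) (∑-cong Y (λ y₂ →
       trans (∑-concatMap _ U _) (∑-cong U (λ u₁ → ∑-map _ U _)))))) ⟩
    ∑ Y (λ y₁ → ∑ Y (λ y₂ → ∑ U (λ u₁ → ∑ U (λ u₂ → ind (solves ((y₁ , y₂) , (u₁ , u₂)))))))
  ≡⟨ ∑-cong Y (λ y₁ → ∑-cong Y (λ y₂ → ∑-independent (allVecs 2) (equation y₁ y₂) n)) ⟩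
    ∑ Y (λ y₁ → ∑ Y (λ y₂ → ∑ (allVecs 2) (λ a → ∑ (allVecs 2) (λ b → ind (equation y₁ y₂ a b))) ^ n))
  ≡⟨ ∑-cong Y (λ y₁ → ∑-cong Y (λ y₂ → cong (_^ n) (solutionCount y₁ y₂))) ⟩
    E k false false (λ W → (+ size W) ^ n) ∎
  where
  Y : List (Vec Bool k)
  Y = allVecs k
  U : List (Vec (PolyLt 2) n)
  U = allVecsOf (allVecs 2) n
  equation : Vec Bool k → Vec Bool k → PolyLt 2 → PolyLt 2 → Bool
  equation y₁ y₂ a b = isZero ((toPoly y₁ ⊗ toPoly a) ⊕ (toPoly y₂ ⊗ toPoly b))

∑𝔽₂² : (Bool → Bool → ℤ) → ℤ
∑𝔽₂² g = (g false false + g false true) + (g true false + g true true)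

∑-allVecs-suc : ∀ k (f : Vec Bool (suc k) → ℤ) →
  ∑ (allVecs (suc k)) f ≡ ∑ (allVecs k) (λ v → f (false ∷ v)) + ∑ (allVecs k) (λ v → f (true ∷ v))
∑-allVecs-suc k f =
  trans (∑-concatMap _ (allVecs k) f)
        (trans (∑-cong (allVecs k) (λ v → cong (_+_ (f (false ∷ v))) (ℤ.+-identityʳ _)))
               (∑-+ (allVecs k) _ _))

transfer : ∀ k u w (φ : Mask → ℤ) →
  E (suc k) u w φ ≡ ∑𝔽₂² (λ c₁ c₂ → E k c₁ c₂ (λ W → φ (local u w c₁ c₂ ∩ W)))
transfer k u w φ = trans (∑-allVecs-suc k _) (cong₂ _+_ (split false) (split true))
  where
  V : List (Vec Bool k)
  V = allVecs k
  split : ∀ c₁ → ∑ V (λ v₁ → ∑ (allVecs (suc k)) (λ y₂ → φ (mask u w (c₁ ∷ v₁) y₂)))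
               ≡ E k c₁ false (λ W → φ (local u w c₁ false ∩ W)) + E k c₁ true (λ W → φ (local u w c₁ true ∩ W))
  split c₁ = trans (∑-cong V (λ v₁ → trans (∑-allVecs-suc k _)
                     (cong₂ _+_ (∑-cong V (λ v₂ → cong φ (mask-∷ u w c₁ false v₁ v₂)))
                                (∑-cong V (λ v₂ → cong φ (mask-∷ u w c₁ true v₁ v₂))))))
                   (∑-+ V _ _)

-- A formal ℤ-linear combination of keys, evaluated against a weight φ.
FSum : Set → Set
FSum K = List (ℤ × K)

⟦_⟧ : ∀ {K : Set} → FSum K → (K → ℤ) → ℤ
⟦ L ⟧ φ = ∑ L (λ e → proj₁ e * φ (proj₂ e))

rescale : ∀ {K : Set} → ℤ → FSum K → FSum K
rescale a = map (λ e → (a * proj₁ e , proj₂ e))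

⟦rescale⟧ : ∀ {K : Set} a (L : FSum K) φ → ⟦ rescale a L ⟧ φ ≡ a * ⟦ L ⟧ φ
⟦rescale⟧ a L φ =
  trans (∑-map _ L _) (trans (∑-cong L (λ e → ℤ.*-assoc a (proj₁ e) (φ (proj₂ e)))) (∑-*ˡ L a _))

rekey : ∀ {K K′ : Set} → (K → K′) → FSum K → FSum K′
rekey f = map (λ e → (proj₁ e , f (proj₂ e)))

⟦rekey⟧ : ∀ {K K′ : Set} (f : K → K′) (L : FSum K) ψ → ⟦ rekey f L ⟧ ψ ≡ ⟦ L ⟧ (λ x → ψ (f x))
⟦rekey⟧ f L ψ = ∑-map _ L _

module Collect {K : Set} (_≟_ : DecidableEquality K) where

  insert : ℤ × K → FSum K → FSum K
  insert (a , x) [] = (a , x) ∷ []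
  insert (a , x) ((b , y) ∷ L) with x ≟ y
  ... | yes _ = (a + b , y) ∷ L
  ... | no _ = (b , y) ∷ insert (a , x) L

  collect : FSum K → FSum K
  collect = foldr insert []

  ⟦insert⟧ : ∀ a x L φ → ⟦ insert (a , x) L ⟧ φ ≡ a * φ x + ⟦ L ⟧ φ
  ⟦insert⟧ a x [] φ = refl
  ⟦insert⟧ a x ((b , y) ∷ L) φ with x ≟ y
  ... | yes refl = merge a b (φ x) (⟦ L ⟧ φ)
    where
    merge : ∀ a b p r → (a + b) * p + r ≡ a * p + (b * p + r)
    merge = solve-∀
  ... | no _ = trans (cong (_+_ (b * φ y)) (⟦insert⟧ a x L φ)) (swap (b * φ y) (a * φ x) (⟦ L ⟧ φ))
    where
    swap : ∀ p q r → p + (q + r) ≡ q + (p + r)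
    swap = solve-∀

  ⟦collect⟧ : ∀ L φ → ⟦ collect L ⟧ φ ≡ ⟦ L ⟧ φ
  ⟦collect⟧ [] φ = refl
  ⟦collect⟧ ((a , x) ∷ L) φ = trans (⟦insert⟧ a x (collect L) φ) (cong (_+_ (a * φ x)) (⟦collect⟧ L φ))

open Collect using (collect; ⟦collect⟧)

Null : ∀ {K : Set} → FSum K → Set
Null = All (λ e → proj₁ e ≡ + 0)

⟦Null⟧ : ∀ {K : Set} {L : FSum K} → Null L → ∀ φ → ⟦ L ⟧ φ ≡ + 0
⟦Null⟧ [] φ = refl
⟦Null⟧ (refl ∷ zeros) φ = trans (ℤ.+-identityˡ _) (⟦Null⟧ zeros φ)

by-computation : ∀ {K : Set} {L : FSum K} → True (all? (λ e → proj₁ e ℤ.≟ + 0) L) → Null L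
by-computation = toWitness

-- The recurrence e(k+3) - 7 e(k+2) + 14 e(k+1) - 8 e(k) = 0, whose characteristic
-- polynomial (X - 1)(X - 2)(X - 4) has the roots 1, 2, 4.
lin : ℤ → ℤ → ℤ → ℤ → ℤ
lin e₃ e₂ e₁ e₀ = e₃ - + 7 * e₂ + + 14 * e₁ - + 8 * e₀

Recurrent : (ℕ → ℤ) → Set
Recurrent e = ∀ k → lin (e (3 +ₙ k)) (e (2 +ₙ k)) (e (1 +ₙ k)) (e k) ≡ + 0

lin-cong : ∀ {a a′ b b′ c c′ d d′} → a ≡ a′ → b ≡ b′ → c ≡ c′ → d ≡ d′ → lin a b c d ≡ lin a′ b′ c′ d′
lin-cong refl refl refl refl = refl

lin-+ : ∀ a b c d a′ b′ c′ d′ →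
  (a + a′) - + 7 * (b + b′) + + 14 * (c + c′) - + 8 * (d + d′)
  ≡ (a - + 7 * b + + 14 * c - + 8 * d) + (a′ - + 7 * b′ + + 14 * c′ - + 8 * d′)
lin-+ = solve-∀

lin-∑𝔽₂² : ∀ g₃ g₂ g₁ g₀ → lin (∑𝔽₂² g₃) (∑𝔽₂² g₂) (∑𝔽₂² g₁) (∑𝔽₂² g₀)
  ≡ ∑𝔽₂² (λ c₁ c₂ → lin (g₃ c₁ c₂) (g₂ c₁ c₂) (g₁ c₁ c₂) (g₀ c₁ c₂))
lin-∑𝔽₂² g₃ g₂ g₁ g₀ =
  trans (split (λ c → g₃ c false + g₃ c true) (λ c → g₂ c false + g₂ c true)
               (λ c → g₁ c false + g₁ c true) (λ c → g₀ c false + g₀ c true))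
        (cong₂ _+_ (split (g₃ false) (g₂ false) (g₁ false) (g₀ false))
                   (split (g₃ true) (g₂ true) (g₁ true) (g₀ true)))
  where
  split : ∀ (h₃ h₂ h₁ h₀ : Bool → ℤ) →
    lin (h₃ false + h₃ true) (h₂ false + h₂ true) (h₁ false + h₁ true) (h₀ false + h₀ true)
    ≡ lin (h₃ false) (h₂ false) (h₁ false) (h₀ false) + lin (h₃ true) (h₂ true) (h₁ true) (h₀ true)
  split h₃ h₂ h₁ h₀ = lin-+ (h₃ false) (h₂ false) (h₁ false) (h₀ false) (h₃ true) (h₂ true) (h₁ true) (h₀ true)

lin-injective : ∀ {x y} b c d → lin x b c d ≡ + 0 → lin y b c d ≡ + 0 → x ≡ y
lin-injective {x} {y} b c d p q = begin
    x                       ≡⟨ isolate x b c d ⟩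
    lin x b c d + rest      ≡⟨ cong (_+ rest) (trans p (sym q)) ⟩
    lin y b c d + rest      ≡⟨ sym (isolate y b c d) ⟩
    y                       ∎
  where
  rest : ℤ
  rest = + 7 * b - + 14 * c + + 8 * d
  isolate : ∀ x b c d → x ≡ (x - + 7 * b + + 14 * c - + 8 * d) + (+ 7 * b - + 14 * c + + 8 * d)
  isolate = solve-∀

recurrence-unique : ∀ (e f : ℕ → ℤ) → Recurrent e → Recurrent f →
  e 0 ≡ f 0 → e 1 ≡ f 1 → e 2 ≡ f 2 → ∀ k → e k ≡ f k
recurrence-unique e f rec-e rec-f p₀ p₁ p₂ k = proj₁ (agree k)
  where
  agree : ∀ k → e k ≡ f k × e (1 +ₙ k) ≡ f (1 +ₙ k) × e (2 +ₙ k) ≡ f (2 +ₙ k)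
  agree zero = p₀ , p₁ , p₂
  agree (suc k) with agree k
  ... | q₀ , q₁ , q₂ = q₁ , q₂ ,
    lin-injective (f (2 +ₙ k)) (f (1 +ₙ k)) (f k)
      (trans (sym (lin-cong (refl {x = e (3 +ₙ k)}) q₂ q₁ q₀)) (rec-e k)) (rec-f k)

geometric : ℤ → ℤ → ℤ → ℕ → ℤ
geometric a b c k = a + b * (+ 2) ^ k + c * ((+ 2) ^ k * (+ 2) ^ k)

geometric-recurrent : ∀ a b c → Recurrent (geometric a b c)
geometric-recurrent a b c k = identity a b c ((+ 2) ^ k)
  where
  identity : ∀ a b c t → let g = λ s → a + b * s + c * (s * s) in
    g (+ 2 * (+ 2 * (+ 2 * t))) - + 7 * g (+ 2 * (+ 2 * t)) + + 14 * g (+ 2 * t) - + 8 * g t ≡ + 0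
  identity = solve-∀

histogram : ℕ → Bool → Bool → FSum Mask
histogram k u w = concatMap (λ y₁ → map (λ y₂ → (+ 1 , mask u w y₁ y₂)) (allVecs k)) (allVecs k)

E≡⟦histogram⟧ : ∀ k u w φ → E k u w φ ≡ ⟦ histogram k u w ⟧ φ
E≡⟦histogram⟧ k u w φ = sym (begin
    ⟦ histogram k u w ⟧ φ
  ≡⟨ ∑-concatMap _ (allVecs k) _ ⟩
    ∑ (allVecs k) (λ y₁ → ∑ (map (λ y₂ → (+ 1 , mask u w y₁ y₂)) (allVecs k)) (λ e → proj₁ e * φ (proj₂ e)))
  ≡⟨ ∑-cong (allVecs k) (λ y₁ → trans (∑-map _ (allVecs k) _) (∑-cong (allVecs k) (λ y₂ → ℤ.*-identityˡ _))) ⟩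
    E k u w φ ∎)

combination : ∀ {K : Set} → FSum K → FSum K → FSum K → FSum K → FSum K
combination L₃ L₂ L₁ L₀ = L₃ ++ (rescale (- + 7) L₂ ++ (rescale (+ 14) L₁ ++ rescale (- + 8) L₀))

⟦combination⟧ : ∀ {K : Set} (L₃ L₂ L₁ L₀ : FSum K) φ →
  ⟦ combination L₃ L₂ L₁ L₀ ⟧ φ ≡ lin (⟦ L₃ ⟧ φ) (⟦ L₂ ⟧ φ) (⟦ L₁ ⟧ φ) (⟦ L₀ ⟧ φ)
⟦combination⟧ L₃ L₂ L₁ L₀ φ = begin
    ⟦ combination L₃ L₂ L₁ L₀ ⟧ φ
  ≡⟨ ∑-++ L₃ _ _ ⟩
    ⟦ L₃ ⟧ φ + ⟦ rescale (- + 7) L₂ ++ (rescale (+ 14) L₁ ++ rescale (- + 8) L₀) ⟧ φ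
  ≡⟨ cong (_+_ (⟦ L₃ ⟧ φ)) (trans (∑-++ (rescale (- + 7) L₂) _ _) (cong (_+_ (⟦ rescale (- + 7) L₂ ⟧ φ)) (∑-++ (rescale (+ 14) L₁) _ _))) ⟩
    ⟦ L₃ ⟧ φ + (⟦ rescale (- + 7) L₂ ⟧ φ + (⟦ rescale (+ 14) L₁ ⟧ φ + ⟦ rescale (- + 8) L₀ ⟧ φ))
  ≡⟨ cong (_+_ (⟦ L₃ ⟧ φ)) (cong₂ _+_ (⟦rescale⟧ (- + 7) L₂ φ) (cong₂ _+_ (⟦rescale⟧ (+ 14) L₁ φ) (⟦rescale⟧ (- + 8) L₀ φ))) ⟩
    ⟦ L₃ ⟧ φ + ((- + 7) * ⟦ L₂ ⟧ φ + (+ 14 * ⟦ L₁ ⟧ φ + (- + 8) * ⟦ L₀ ⟧ φ))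
  ≡⟨ as-lin (⟦ L₃ ⟧ φ) (⟦ L₂ ⟧ φ) (⟦ L₁ ⟧ φ) (⟦ L₀ ⟧ φ) ⟩
    lin (⟦ L₃ ⟧ φ) (⟦ L₂ ⟧ φ) (⟦ L₁ ⟧ φ) (⟦ L₀ ⟧ φ) ∎
  where
  as-lin : ∀ a b c d → a + ((- + 7) * b + (+ 14 * c + (- + 8) * d)) ≡ a - + 7 * b + + 14 * c - + 8 * d
  as-lin = solve-∀

recurrence-defect : Bool → Bool → FSum Mask
recurrence-defect u w = collect (≡-dec _≟ᵇ_)
  (combination (histogram 4 u w) (histogram 3 u w) (histogram 2 u w) (histogram 1 u w))

defect-null : ∀ u w → Null (recurrence-defect u w)
defect-null false false = by-computation _
defect-null false true = by-computation _
defect-null true false = by-computation _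
defect-null true true = by-computation _

recurrence-base : ∀ u w φ → lin (E 4 u w φ) (E 3 u w φ) (E 2 u w φ) (E 1 u w φ) ≡ + 0
recurrence-base u w φ = begin
    lin (E 4 u w φ) (E 3 u w φ) (E 2 u w φ) (E 1 u w φ)
  ≡⟨ lin-cong (E≡⟦histogram⟧ 4 u w φ) (E≡⟦histogram⟧ 3 u w φ) (E≡⟦histogram⟧ 2 u w φ) (E≡⟦histogram⟧ 1 u w φ) ⟩
    lin (⟦ H 4 ⟧ φ) (⟦ H 3 ⟧ φ) (⟦ H 2 ⟧ φ) (⟦ H 1 ⟧ φ)
  ≡⟨ sym (⟦combination⟧ (H 4) (H 3) (H 2) (H 1) φ) ⟩
    ⟦ combination (H 4) (H 3) (H 2) (H 1) ⟧ φ
  ≡⟨ sym (⟦collect⟧ (≡-dec _≟ᵇ_) (combination (H 4) (H 3) (H 2) (H 1)) φ) ⟩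
    ⟦ recurrence-defect u w ⟧ φ
  ≡⟨ ⟦Null⟧ (defect-null u w) φ ⟩
    + 0 ∎
  where
  H : ℕ → FSum Mask
  H k = histogram k u w

E-recurrent : ∀ k u w φ →
  lin (E (4 +ₙ k) u w φ) (E (3 +ₙ k) u w φ) (E (2 +ₙ k) u w φ) (E (1 +ₙ k) u w φ) ≡ + 0
E-recurrent zero u w φ = recurrence-base u w φ
E-recurrent (suc k) u w φ = begin
    lin (E (5 +ₙ k) u w φ) (E (4 +ₙ k) u w φ) (E (3 +ₙ k) u w φ) (E (2 +ₙ k) u w φ)
  ≡⟨ lin-cong (transfer (4 +ₙ k) u w φ) (transfer (3 +ₙ k) u w φ) (transfer (2 +ₙ k) u w φ) (transfer (1 +ₙ k) u w φ) ⟩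
    lin (∑𝔽₂² (next (4 +ₙ k))) (∑𝔽₂² (next (3 +ₙ k))) (∑𝔽₂² (next (2 +ₙ k))) (∑𝔽₂² (next (1 +ₙ k)))
  ≡⟨ lin-∑𝔽₂² (next (4 +ₙ k)) (next (3 +ₙ k)) (next (2 +ₙ k)) (next (1 +ₙ k)) ⟩
    ∑𝔽₂² (λ c₁ c₂ → lin (next (4 +ₙ k) c₁ c₂) (next (3 +ₙ k) c₁ c₂) (next (2 +ₙ k) c₁ c₂) (next (1 +ₙ k) c₁ c₂))
  ≡⟨ cong₂ _+_ (cong₂ _+_ (IH false false) (IH false true)) (cong₂ _+_ (IH true false) (IH true true)) ⟩
    + 0 ∎
  where
  next : ℕ → Bool → Bool → ℤ
  next m c₁ c₂ = E m c₁ c₂ (λ W → φ (local u w c₁ c₂ ∩ W))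
  IH : ∀ c₁ c₂ → lin (next (4 +ₙ k) c₁ c₂) (next (3 +ₙ k) c₁ c₂) (next (2 +ₙ k) c₁ c₂) (next (1 +ₙ k) c₁ c₂) ≡ + 0
  IH c₁ c₂ = E-recurrent k c₁ c₂ (λ W → φ (local u w c₁ c₂ ∩ W))

profile : ℕ → FSum ℤ
profile k = collect ℤ._≟_ (rekey (λ W → + size W) (histogram k false false))

E≡⟦profile⟧ : ∀ k (ψ : ℤ → ℤ) → E k false false (λ W → ψ (+ size W)) ≡ ⟦ profile k ⟧ ψ
E≡⟦profile⟧ k ψ = begin
    E k false false (λ W → ψ (+ size W))
  ≡⟨ E≡⟦histogram⟧ k false false _ ⟩
    ⟦ histogram k false false ⟧ (λ W → ψ (+ size W))
  ≡⟨ sym (⟦rekey⟧ (λ W → + size W) (histogram k false false) ψ) ⟩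
    ⟦ rekey (λ W → + size W) (histogram k false false) ⟧ ψ
  ≡⟨ sym (⟦collect⟧ ℤ._≟_ (rekey (λ W → + size W) (histogram k false false)) ψ) ⟩
    ⟦ profile k ⟧ ψ ∎

-- The sizes that occur are powers of two (solution sets are 𝔽₂-subspaces), so
-- a profile is recorded by the number of Y with each exponent d; the three
-- profiles below are checked by computation.
powersOfTwo : FSum ℕ → FSum ℤ
powersOfTwo = rekey ((+ 2) ^_)

dims₁ : FSum ℕ
dims₁ = (+ 3 , 2) ∷ (+ 1 , 4) ∷ []

dims₂ : FSum ℕ
dims₂ = (+ 9 , 2) ∷ (+ 6 , 1) ∷ (+ 1 , 4) ∷ []

dims₃ : FSum ℕ
dims₃ = (+ 21 , 2) ∷ (+ 24 , 0) ∷ (+ 18 , 1) ∷ (+ 1 , 4) ∷ []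

profile₁ : profile 1 ≡ powersOfTwo dims₁
profile₁ = refl

profile₂ : profile 2 ≡ powersOfTwo dims₂
profile₂ = refl

profile₃ : profile 3 ≡ powersOfTwo dims₃
profile₃ = refl

pow-mul : ∀ m n → (+ 2) ^ (m *ₙ n) ≡ ((+ 2) ^ n) ^ m
pow-mul m n = trans (cong ((+ 2) ^_) (ℕ.*-comm m n)) (sym (ℤ.^-*-assoc (+ 2) n m))

pow-comm : ∀ a b → ((+ 2) ^ a) ^ b ≡ ((+ 2) ^ b) ^ a
pow-comm a b = trans (ℤ.^-*-assoc (+ 2) a b) (pow-mul a b)

⟦powersOfTwo⟧ : ∀ (L : FSum ℕ) n → ⟦ powersOfTwo L ⟧ (_^ n) ≡ ⟦ L ⟧ (((+ 2) ^ n) ^_)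
⟦powersOfTwo⟧ L n = trans (⟦rekey⟧ ((+ 2) ^_) L (_^ n))
  (∑-cong L (λ e → cong (proj₁ e *_) (pow-comm (proj₂ e) n)))

-- With x = 2ⁿ and t = 2ᵏ⁻¹ the claimed value is coeff₀ x + coeff₁ x · t + 4 t².
coeff₀ coeff₁ : ℤ → ℤ
coeff₀ x = x ^ 4 - + 3 * x ^ 2 - + 6 * x + + 8
coeff₁ x = + 6 * x ^ 2 + + 6 * x - + 12

closedForm : ℤ → ℕ → ℤ
closedForm x = geometric (coeff₀ x) (coeff₁ x) (+ 4)

-- It matches the initial values read off from the profiles (here x² and x⁴
-- are spelled out as the products that x ^ 2 and x ^ 4 unfold to).
initial₁ : ∀ x → ⟦ dims₁ ⟧ (x ^_) ≡ closedForm x 0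
initial₁ = identity
  where
  identity : ∀ x → let x² = x * (x * + 1); x⁴ = x * (x * x²) in
    + 3 * x² + (+ 1 * x⁴ + + 0)
    ≡ (x⁴ - + 3 * x² - + 6 * x + + 8) + (+ 6 * x² + + 6 * x - + 12) * + 1 + + 4 * (+ 1 * + 1)
  identity = solve-∀

initial₂ : ∀ x → ⟦ dims₂ ⟧ (x ^_) ≡ closedForm x 1
initial₂ = identity
  where
  identity : ∀ x → let x² = x * (x * + 1); x⁴ = x * (x * x²) in
    + 9 * x² + (+ 6 * (x * + 1) + (+ 1 * x⁴ + + 0))
    ≡ (x⁴ - + 3 * x² - + 6 * x + + 8) + (+ 6 * x² + + 6 * x - + 12) * + 2 + + 4 * (+ 2 * + 2)
  identity = solve-∀

initial₃ : ∀ x → ⟦ dims₃ ⟧ (x ^_) ≡ closedForm x 2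
initial₃ = identity
  where
  identity : ∀ x → let x² = x * (x * + 1); x⁴ = x * (x * x²) in
    + 21 * x² + (+ 24 * + 1 + (+ 18 * (x * + 1) + (+ 1 * x⁴ + + 0)))
    ≡ (x⁴ - + 3 * x² - + 6 * x + + 8) + (+ 6 * x² + + 6 * x - + 12) * + 4 + + 4 * (+ 4 * + 4)
  identity = solve-∀

E-closedForm : ∀ n j → E (suc j) false false (λ W → (+ size W) ^ n) ≡ closedForm ((+ 2) ^ n) j
E-closedForm n =
  recurrence-unique e (closedForm x) (λ j → E-recurrent j false false φ) (geometric-recurrent (coeff₀ x) (coeff₁ x) (+ 4))
    (initial 0 dims₁ profile₁ (initial₁ x)) (initial 1 dims₂ profile₂ (initial₂ x)) (initial 2 dims₃ profile₃ (initial₃ x))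
  where
  x : ℤ
  x = (+ 2) ^ n
  φ : Mask → ℤ
  φ W = (+ size W) ^ n
  e : ℕ → ℤ
  e j = E (suc j) false false φ
  initial : ∀ j L → profile (suc j) ≡ powersOfTwo L → ⟦ L ⟧ (x ^_) ≡ closedForm x j → e j ≡ closedForm x j
  initial j L profile-L value = begin
      e j                         ≡⟨ E≡⟦profile⟧ (suc j) (_^ n) ⟩
      ⟦ profile (suc j) ⟧ (_^ n)  ≡⟨ cong (λ P → ⟦ P ⟧ (_^ n)) profile-L ⟩
      ⟦ powersOfTwo L ⟧ (_^ n)    ≡⟨ ⟦powersOfTwo⟧ L n ⟩
      ⟦ L ⟧ (x ^_)                ≡⟨ value ⟩
      closedForm x j              ∎

closedForm-formula : ∀ n j → closedForm ((+ 2) ^ n) j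
  ≡ (+ 2) ^ (2 *ₙ suc j) + (+ 3) * ((+ 2) ^ (2 *ₙ n) - + 1) * (+ 2) ^ suc j
    + (+ 6) * ((+ 2) ^ n - + 1) * (+ 2) ^ j
    + (+ 2) ^ (4 *ₙ n) - (+ 3) * (+ 2) ^ (2 *ₙ n) - (+ 6) * (+ 2) ^ n + (+ 8)
closedForm-formula n j = expand ((+ 2) ^ n) ((+ 2) ^ j) (pow-mul 2 (suc j)) (pow-mul 2 n) (pow-mul 4 n)
  where
  expand : ∀ x t {u₂ s₂ s₄} → u₂ ≡ (+ 2 * t) ^ 2 → s₂ ≡ x ^ 2 → s₄ ≡ x ^ 4 →
    (x ^ 4 - + 3 * x ^ 2 - + 6 * x + + 8) + (+ 6 * x ^ 2 + + 6 * x - + 12) * t + + 4 * (t * t)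
    ≡ u₂ + (+ 3) * (s₂ - + 1) * (+ 2 * t) + (+ 6) * (x - + 1) * t + s₄ - (+ 3) * s₂ - (+ 6) * x + (+ 8)
  expand x t refl refl refl = identity x t
    where
    identity : ∀ x t → let x² = x * (x * + 1); x⁴ = x * (x * x²); u = + 2 * t in
      (x⁴ - + 3 * x² - + 6 * x + + 8) + (+ 6 * x² + + 6 * x - + 12) * t + + 4 * (t * t)
      ≡ u * (u * + 1) + (+ 3) * (x² - + 1) * u + (+ 6) * (x - + 1) * t + x⁴ - (+ 3) * x² - (+ 6) * x + (+ 8)
    identity = solve-∀

theorem4p1 : (n k : ℕ) → n ≥ 1 → k ≥ 1 →
    + (R2 n k) ≡ (+ 2) ^ (2 Data.Nat.* k)
      + (+ 3) * ((+ 2) ^ (2 Data.Nat.* n) - + 1) * (+ 2) ^ k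
      + (+ 6) * ((+ 2) ^ n - + 1) * (+ 2) ^ (k ∸ 1)
      + (+ 2) ^ (4 Data.Nat.* n) - (+ 3) * (+ 2) ^ (2 Data.Nat.* n)
      - (+ 6) * (+ 2) ^ n + (+ 8)
theorem4p1 n zero _ ()
theorem4p1 n (suc j) _ _ = begin
    + R2 n (suc j)                                     ≡⟨ R2≡E n (suc j) ⟩
    E (suc j) false false (λ W → (+ size W) ^ n)       ≡⟨ E-closedForm n j ⟩
    closedForm ((+ 2) ^ n) j                           ≡⟨ closedForm-formula n j ⟩
    _                                                  ∎
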